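{- Let $k\ge 2$ and $n\ge 1$. Let $\phi$ be a bijection from the set of landing orders $\{(j,x): 1\le j\le k,\ 1\le x\le k^{n-1}\}$ to the set of chips $\{1,\dots,k^n\}$ that respects the domination order, i.e. $\phi(j,x)<\phi(j',x')$ whenever $j\le j'$, $x\le x'$ and $(j,x)\ne(j',x')$. Then there exists a sequence of firings of the root after which, for every $(j,x)$, the $x$-th smallest chip at the $j$-th leftmost child of the root is $\phi(j,x)$.
   Context: The infinite rooted directed $k$-ary tree: every vertex has $k$ children ordered from leftmost (1st) to rightmost ($k$th). Labeled chip-firing: initially chips labeled $1,\dots,k^n$ are on the root; a vertex holding at least $k$ chips may fire by choosing any $k$ of its chips and sending the chip with the $r$-th smallest label to its $r$-th leftmost child ($r=1,\dots,k$). The root fires $k^{n-1}$ times, after which each child of the root has $k^{n-1}$ chips. -}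

module Defs where

open import Data.Nat using (ℕ; _^_; _∸_)
open import Data.Fin using (Fin; toℕ) renaming (_<_ to _<ᶠ_; _≤_ to _≤ᶠ_)
open import Data.Fin.Properties using (_<?_)
open import Data.List using (List; length; filter; map; allFin)
open import Data.List.Membership.Propositional using (_∈_)
open import Data.Product using (_×_; _,_; Σ)
open import Relation.Binary.PropositionalEquality using (_≡_; _≢_)
open import Function.Definitions using (Injective)
open import Function.Bundles using (_⤖_)

-- Conventions (0-indexed): children j : Fin k (j = 0 is the leftmost child),
-- ranks x : Fin (k ^ (n ∸ 1)) (x = 0 is the smallest), chips are labelled by
-- Fin (k ^ n) (label c stands for chip c+1; the order is the same).

-- A sequence of root firings, all performed from the initial configuration
-- (all k^n chips on the root), consisting of k^(n-1) firings.
-- Firing number i chooses k chips  chip i 0 < chip i 1 < ... < chip i (k-1);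
-- the chip with the r-th smallest label goes to the r-th leftmost child.
-- A chip can only be chosen if it is still on the root, i.e. the chosen
-- chips are pairwise distinct over the whole sequence.
record RootFiringSequence (k n : ℕ) : Set where
  field
    chip       : Fin (k ^ (n ∸ 1)) → Fin k → Fin (k ^ n)
    increasing : ∀ i {r s : Fin k} → r <ᶠ s → chip i r <ᶠ chip i s
    distinct   : ∀ {i i' : Fin (k ^ (n ∸ 1))} {r r' : Fin k} →
                 chip i r ≡ chip i' r' → (i ≡ i') × (r ≡ r')

open RootFiringSequence public

chipsAtChild : ∀ {k n} → RootFiringSequence k n → Fin k → List (Fin (k ^ n))
chipsAtChild F j = map (λ i → chip F i j) (allFin _)

IsXthSmallest : ∀ {N} → List (Fin N) → ℕ → Fin N → Set
IsXthSmallest L x c = (c ∈ L) × (length (filter (_<? c) L) ≡ x)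

RespectsDomination : ∀ {k m N} → (Fin k × Fin m → Fin N) → Set
RespectsDomination {k} {m} φ =
  ∀ (j j' : Fin k) (x x' : Fin m) → j ≤ᶠ j' → x ≤ᶠ x' →
  (j , x) ≢ (j' , x') → φ (j , x) <ᶠ φ (j' , x')

{-# OPTIONS --safe #-}
module Submission where

-- The firing sequence is read off φ directly: firing number x sends chip
-- φ (j , x) to child j.  Domination in the first coordinate makes each firing
-- increasing, injectivity of φ makes the chosen chips distinct, and domination
-- in the second coordinate makes child j receive φ (j , 0) < φ (j , 1) < ⋯,
-- so φ (j , x) is its x-th smallest chip.

open import Defs
open import Data.Nat using (ℕ; _^_; _∸_; _≥_; suc; z<s; s<s)
import Data.Nat.Properties as ℕ
open import Data.Fin using (Fin; toℕ; _<_) renaming (zero to fzero; suc to fsuc)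
open import Data.Fin.Properties using (_<?_; <-cmp; <-asym; <⇒≢)
open import Data.List using (length; filter; tabulate)
open import Data.List.Properties using (filter-accept; filter-none; map-tabulate)
open import Data.List.Relation.Unary.All.Properties using (tabulate⁺)
open import Data.List.Membership.Propositional.Properties using (∈-tabulate⁺)
open import Data.Product using (_×_; _,_; Σ)
open import Data.Product.Properties using (,-injectiveˡ; ,-injectiveʳ)
open import Data.Empty using (⊥-elim)
open import Function using (_∘_; id)
open import Function.Bundles using (_⤖_; Bijection)
open import Function.Definitions using (Injective)
open import Level using (Level)
open import Relation.Binary.Definitions using (Monotonic₁; tri<; tri≈; tri>)
open import Relation.Binary.PropositionalEquality using (_≡_; refl; sym; cong; subst)
open import Relation.Unary using (Pred; Decidable)

module _ {a p : Level} {A : Set a} {P : Pred A p} (P? : Decidable P) where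

  length-filter-tabulate : ∀ {m} (g : Fin m → A) (x : Fin m) →
    (∀ i → P (g i) → i < x) → (∀ i → i < x → P (g i)) →
    length (filter P? (tabulate g)) ≡ toℕ x
  length-filter-tabulate g fzero only-below _ =
    cong length (filter-none P? (tabulate⁺ (λ i → ℕ.n≮0 ∘ only-below i)))
  length-filter-tabulate g (fsuc x) only-below all-below
    rewrite filter-accept P? {xs = tabulate (g ∘ fsuc)} (all-below fzero z<s) =
    cong suc (length-filter-tabulate (g ∘ fsuc) x
      (λ i → ℕ.≤-pred ∘ only-below (fsuc i)) (λ i → all-below (fsuc i) ∘ s<s))

module _ {m N : ℕ} {g : Fin m → Fin N} (g-mono : Monotonic₁ _<_ _<_ g) where

  strictMono⇒cancel-< : ∀ {i j} → g i < g j → i < j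
  strictMono⇒cancel-< {i} {j} gi<gj with <-cmp i j
  ... | tri< i<j _ _ = i<j
  ... | tri≈ _ refl _ = ⊥-elim (<⇒≢ gi<gj refl)
  ... | tri> _ _ j<i = ⊥-elim (<-asym gi<gj (g-mono j<i))

  strictMono⇒isXthSmallest : ∀ x → IsXthSmallest (tabulate g) (toℕ x) (g x)
  strictMono⇒isXthSmallest x =
    ∈-tabulate⁺ x ,
    length-filter-tabulate (_<? g x) g x (λ _ → strictMono⇒cancel-<) (λ _ → g-mono)

module _ {k m N : ℕ} {f : Fin k × Fin m → Fin N} (dom : RespectsDomination f) where

  respectsDomination⇒monoˡ : ∀ x → Monotonic₁ _<_ _<_ (λ j → f (j , x))
  respectsDomination⇒monoˡ x {j} {j'} j<j' =
    dom j j' x x (ℕ.<⇒≤ j<j') ℕ.≤-refl (<⇒≢ j<j' ∘ ,-injectiveˡ)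

  respectsDomination⇒monoʳ : ∀ j → Monotonic₁ _<_ _<_ (λ x → f (j , x))
  respectsDomination⇒monoʳ j {x} {x'} x<x' =
    dom j j x x' ℕ.≤-refl (ℕ.<⇒≤ x<x') (<⇒≢ x<x' ∘ ,-injectiveʳ)

module FiringSequenceOf {k n : ℕ} {f : Fin k × Fin (k ^ (n ∸ 1)) → Fin (k ^ n)}
         (f-injective : Injective _≡_ _≡_ f)
         (f-monoˡ : ∀ x → Monotonic₁ _<_ _<_ (λ j → f (j , x))) where

  firingSequenceOf : RootFiringSequence k n
  firingSequenceOf = record
    { chip       = λ x j → f (j , x)
    ; increasing = f-monoˡ
    ; distinct   = λ eq → let same = f-injective eq in ,-injectiveʳ same , ,-injectiveˡ same
    }

  chipsAtChild-firingSequenceOf : ∀ j →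
    chipsAtChild firingSequenceOf j ≡ tabulate (λ x → f (j , x))
  chipsAtChild-firingSequenceOf j = map-tabulate id (λ x → f (j , x))

proposition4p4 : (k n : ℕ) → k ≥ 2 → n ≥ 1 →
    (φ : (Fin k × Fin (k ^ (n ∸ 1))) ⤖ Fin (k ^ n)) →
    RespectsDomination (Bijection.to φ) →
    Σ (RootFiringSequence k n) λ F →
      ∀ (j : Fin k) (x : Fin (k ^ (n ∸ 1))) →
        IsXthSmallest (chipsAtChild F j) (toℕ x) (Bijection.to φ (j , x))
proposition4p4 k n _ _ φ dom = firingSequenceOf , λ j x →
  subst (λ L → IsXthSmallest L (toℕ x) (to (j , x)))
        (sym (chipsAtChild-firingSequenceOf j))
        (strictMono⇒isXthSmallest (respectsDomination⇒monoʳ dom j) x)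
  where
  open Bijection φ using (to; injective)
  open FiringSequenceOf {n = n} injective (respectsDomination⇒monoˡ dom)
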